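{- Let $G$ be a finite simple graph and let $\varphi,\varphi'$ be sequences of pivot operations both applicable to $G$. If $\sup(\varphi)=\sup(\varphi')$, then $G\varphi=G\varphi'$.
   Context: Graphs are finite and simple. For a vertex $x$, $N(x)$ is its neighbourhood and $N'(x)=N(x)\cup\{x\}$. Pivot: for an edge $\{u,v\}\in E(G)$, let $V_1=N'(u)\setminus N'(v)$, $V_2=N'(v)\setminus N'(u)$, $V_3=N'(u)\cap N'(v)$; $G[uv]$ is obtained from $G$ by toggling every pair $\{x,y\}$ with $x\in V_i$, $y\in V_j$, $i\neq j$, all other adjacencies unchanged. A sequence $[v_1v_2]\cdots[v_{n-1}v_n]$ of pivots is applicable to $G$ if each $\{v_i,v_{i+1}\}$ is an edge of the graph obtained by applying the preceding pivots; $G\varphi$ is the resulting graph. The support $\sup(\varphi)=\{v_1\}\oplus\cdots\oplus\{v_n\}$ ($\oplus$ = symmetric difference) is the set of vertices occurring an odd number of times in the sequence. -}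

module Defs where

open import Data.Nat using (ℕ)
open import Data.Fin using (Fin; _≟_)
open import Data.Bool using (Bool; true; false; not; _∧_; _∨_; _xor_; if_then_else_)
open import Data.Unit using (⊤)
open import Data.List using (List; []; _∷_)
open import Data.Product using (_×_; _,_)
open import Relation.Nullary.Decidable using (⌊_⌋)
open import Relation.Binary.PropositionalEquality using (_≡_)

record Graph (n : ℕ) : Set where
  constructor mkGraph
  field
    adj   : Fin n → Fin n → Bool
    sym   : ∀ x y → adj x y ≡ adj y x
    irref : ∀ x → adj x x ≡ false

open Graph public

_==_ : {n : ℕ} → Fin n → Fin n → Bool
x == y = ⌊ x ≟ y ⌋

inN' : {n : ℕ} → (Fin n → Fin n → Bool) → Fin n → Fin n → Bool
inN' a u x = (x == u) ∨ a u x

data Cls : Set where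
  out c1 c2 c3 : Cls

cls : {n : ℕ} → (Fin n → Fin n → Bool) → Fin n → Fin n → Fin n → Cls
cls a u v x with inN' a u x | inN' a v x
... | true  | false = c1
... | false | true  = c2
... | true  | true  = c3
... | false | false = out

differ : Cls → Cls → Bool
differ out _  = false
differ _  out = false
differ c1 c1 = false
differ c2 c2 = false
differ c3 c3 = false
differ _  _  = true

pivotAdj : {n : ℕ} → (Fin n → Fin n → Bool) → Fin n → Fin n → (Fin n → Fin n → Bool)
pivotAdj a u v x y = a x y xor differ (cls a u v x) (cls a u v y)

-- a sequence of pivots [u₁v₁][u₂v₂]⋯, listed in order of application
PivotSeq : ℕ → Set
PivotSeq n = List (Fin n × Fin n)

applyAdj : {n : ℕ} → (Fin n → Fin n → Bool) → PivotSeq n → (Fin n → Fin n → Bool)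
applyAdj a []            = a
applyAdj a ((u , v) ∷ φ) = applyAdj (pivotAdj a u v) φ

Applicable : {n : ℕ} → (Fin n → Fin n → Bool) → PivotSeq n → Set
Applicable a []            = ⊤
Applicable a ((u , v) ∷ φ) = (a u v ≡ true) × Applicable (pivotAdj a u v) φ

-- x ∈ sup(φ): x occurs an odd number of times in the sequence of vertices
inSup : {n : ℕ} → PivotSeq n → Fin n → Bool
inSup []            x = false
inSup ((u , v) ∷ φ) x = (x == u) xor ((x == v) xor inSup φ x)

_·_ : {n : ℕ} → Graph n → PivotSeq n → (Fin n → Fin n → Bool)
G · φ = applyAdj (adj G) φ

module Submission where

-- Pivots act on the "graph" of the adjacency matrix, viewed over GF(2).
--
-- For an adjacency matrix a, a pair (p , q) of vectors in GF(2)^n belongs to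
-- the linear relation of a when q = a p.  The key fact (the principal pivot
-- transform) is that for an edge uv, the relation of the pivoted matrix
-- a[uv] is obtained from that of a by exchanging the p- and q-coordinates at
-- u and at v.  Iterating, the relation of aφ is obtained from that of a by
-- exchanging the coordinates in sup(φ), so it depends on φ only through its
-- support; and a matrix is recovered from its relation (column y is the
-- image of the unit vector at y).

open import Defs hiding (sym)
open import Data.Nat using (ℕ; suc)
open import Data.Fin using (Fin; _≟_; punchIn)
open import Data.Fin.Properties using (punchInᵢ≢i)
open import Data.Bool using (Bool; true; false; _∧_; _∨_; _xor_; if_then_else_)
open import Data.Bool.Properties
  using (∧-assoc; ∧-comm; ∨-zeroʳ; ∧-distribˡ-xor; ∧-distribʳ-xor; xor-identityʳ; xor-same; xor-comm;
         xor-∧-commutativeRing)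
open import Data.Bool.Solver using (module xor-∧-Solver)
open import Data.Empty using (⊥-elim)
open import Data.Product using (_×_; _,_; proj₁; proj₂)
open import Data.List using (_∷_; [])
open import Data.Vec.Functional using (Vector)
open import Function using (_∘_)
open import Function.Bundles using (_⇔_; mk⇔; Equivalence)
import Function.Properties.Equivalence as ⇔
open import Algebra.Bundles using (CommutativeRing)
open import Relation.Nullary using (yes; no)
open import Relation.Binary.PropositionalEquality
  using (_≡_; _≗_; refl; sym; trans; cong; cong₂; module ≡-Reasoning)

open import Algebra.Properties.Semiring.Sum (CommutativeRing.semiring xor-∧-commutativeRing)
  using (sum; sum-cong-≗; ∑-distrib-+; *-distribˡ-sum; sum-remove; sum-replicate-zero)
open xor-∧-Solver using (solve; _:=_; _:+_; _:*_; con)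
open Equivalence using (to; from)

private variable
  n : ℕ

-- GF(2) vectors and the dot product

_⊕_ : Vector Bool n → Vector Bool n → Vector Bool n
(f ⊕ g) j = f j xor g j

δ : Fin n → Vector Bool n
δ u j = j == u

_∙_ : Vector Bool n → Vector Bool n → Bool
f ∙ g = sum (λ j → f j ∧ g j)

infixl 6 _⊕_
infix 7 _∙_

==-refl : (x : Fin n) → (x == x) ≡ true
==-refl x with x ≟ x
... | yes _ = refl
... | no x≢x = ⊥-elim (x≢x refl)

δ-select : (f : Vector Bool n) (x u : Fin n) → (x == u) ∧ f x ≡ (x == u) ∧ f u
δ-select f x u with x ≟ u
... | yes refl = refl
... | no _     = refl

sum-cong : (f g : Vector Bool n) → f ≗ g → sum f ≡ sum g
sum-cong f g f≗g = sum-cong-≗ {x = f} {y = g} f≗g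

sum-δ : (u : Fin n) (f : Vector Bool n) → sum (λ j → (j == u) ∧ f j) ≡ f u
sum-δ {suc n} u f = begin
  sum t                          ≡⟨ sum-remove {n} {i = u} t ⟩
  t u xor sum (t ∘ punchIn u)    ≡⟨ cong₂ _xor_ (cong (_∧ f u) (==-refl u)) (sum-cong _ (λ _ → false) off-u) ⟩
  f u xor sum {n} (λ _ → false)  ≡⟨ cong (f u xor_) (sum-replicate-zero n) ⟩
  f u xor false                  ≡⟨ xor-identityʳ (f u) ⟩
  f u                            ∎
  where
  open ≡-Reasoning
  t : Vector Bool (suc n)
  t j = (j == u) ∧ f j
  off-u : ∀ j → t (punchIn u j) ≡ false
  off-u j with punchIn u j ≟ u
  ... | yes eq = ⊥-elim (punchInᵢ≢i u j eq)
  ... | no _   = refl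

∙-congʳ : (r : Vector Bool n) {f g : Vector Bool n} → f ≗ g → r ∙ f ≡ r ∙ g
∙-congʳ r f≗g = sum-cong _ _ (λ j → cong (r j ∧_) (f≗g j))

∙-congˡ : {f g : Vector Bool n} → f ≗ g → (r : Vector Bool n) → f ∙ r ≡ g ∙ r
∙-congˡ f≗g r = sum-cong _ _ (λ j → cong (_∧ r j) (f≗g j))

∙-⊕ʳ : (r f g : Vector Bool n) → r ∙ (f ⊕ g) ≡ r ∙ f xor r ∙ g
∙-⊕ʳ r f g = trans (sum-cong _ (λ j → (r j ∧ f j) xor (r j ∧ g j)) (λ j → ∧-distribˡ-xor (r j) (f j) (g j)))
                   (∑-distrib-+ (λ j → r j ∧ f j) (λ j → r j ∧ g j))

∙-⊕ˡ : (f g r : Vector Bool n) → (f ⊕ g) ∙ r ≡ f ∙ r xor g ∙ r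
∙-⊕ˡ f g r = trans (sum-cong _ (λ j → (f j ∧ r j) xor (g j ∧ r j)) (λ j → ∧-distribʳ-xor (r j) (f j) (g j)))
                   (∑-distrib-+ (λ j → f j ∧ r j) (λ j → g j ∧ r j))

∙-scaleˡ : (c : Bool) (f g : Vector Bool n) → (λ j → c ∧ f j) ∙ g ≡ c ∧ f ∙ g
∙-scaleˡ c f g = trans (sum-cong _ (λ j → c ∧ (f j ∧ g j)) (λ j → ∧-assoc c (f j) (g j)))
                       (sym (*-distribˡ-sum c (λ j → f j ∧ g j)))

∙-scaleʳ : (c : Bool) (r f : Vector Bool n) → r ∙ (λ j → c ∧ f j) ≡ c ∧ r ∙ f
∙-scaleʳ c r f = trans (sum-cong _ (λ j → c ∧ (r j ∧ f j)) exchange) (sym (*-distribˡ-sum c (λ j → r j ∧ f j)))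
  where
  exchange : ∀ j → r j ∧ (c ∧ f j) ≡ c ∧ (r j ∧ f j)
  exchange j = solve 3 (λ r c f → r :* (c :* f) := c :* (r :* f)) refl (r j) c (f j)

∙-δʳ : (r : Vector Bool n) (u : Fin n) → r ∙ δ u ≡ r u
∙-δʳ r u = trans (sum-cong _ (λ j → (j == u) ∧ r j) (λ j → ∧-comm (r j) (j == u))) (sum-δ u r)

∙-δˡ : (u : Fin n) (r : Vector Bool n) → δ u ∙ r ≡ r u
∙-δˡ u r = sum-δ u r

-- Linear relations of matrices and coordinate exchanges

Matrix : ℕ → Set
Matrix n = Fin n → Fin n → Bool

Pair : ℕ → Set
Pair n = Vector Bool n × Vector Bool n

Maps : Matrix n → Pair n → Set
Maps a pq = ∀ x → proj₂ pq x ≡ a x ∙ proj₁ pq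

_≋_ : Pair n → Pair n → Set
pq ≋ pq′ = (proj₁ pq ≗ proj₁ pq′) × (proj₂ pq ≗ proj₂ pq′)

Maps-resp : {a b : Matrix n} {pq pq′ : Pair n} →
            (∀ x y → a x y ≡ b x y) → pq ≋ pq′ → Maps a pq → Maps b pq′
Maps-resp {a = a} {b} {pq} {pq′} a≡b (p≗p′ , q≗q′) h x = begin
  proj₂ pq′ x     ≡⟨ sym (q≗q′ x) ⟩
  proj₂ pq x      ≡⟨ h x ⟩
  a x ∙ proj₁ pq  ≡⟨ ∙-congˡ (a≡b x) (proj₁ pq) ⟩
  b x ∙ proj₁ pq  ≡⟨ ∙-congʳ (b x) p≗p′ ⟩
  b x ∙ proj₁ pq′ ∎
  where open ≡-Reasoning

Maps-≋ : {a : Matrix n} {pq pq′ : Pair n} → pq ≋ pq′ → Maps a pq ⇔ Maps a pq′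
Maps-≋ (p≗p′ , q≗q′) = mk⇔ (Maps-resp (λ _ _ → refl) (p≗p′ , q≗q′))
                           (Maps-resp (λ _ _ → refl) ((λ x → sym (p≗p′ x)) , (λ x → sym (q≗q′ x))))

column-Maps : (a : Matrix n) (y : Fin n) → Maps a (δ y , λ x → a x y)
column-Maps a y x = sym (∙-δʳ (a x) y)

Maps-column : (a : Matrix n) {y : Fin n} {q : Vector Bool n} → Maps a (δ y , q) → ∀ x → q x ≡ a x y
Maps-column a {y} h x = trans (h x) (∙-δʳ (a x) y)

swap : Vector Bool n → Pair n → Pair n
swap m pq = (λ x → if m x then proj₂ pq x else proj₁ pq x) , (λ x → if m x then proj₁ pq x else proj₂ pq x)

swap-swap : (m m′ k : Vector Bool n) → (∀ x → k x ≡ m x xor m′ x) → (pq : Pair n) → swap m′ (swap m pq) ≋ swap k pq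
swap-swap m m′ k k≡m⊕m′ (p , q) = (λ x → exchange x q p) , (λ x → exchange x p q)
  where
  if-if : ∀ (b b′ y z : Bool) → (if b′ then (if b then z else y) else (if b then y else z)) ≡ (if b xor b′ then y else z)
  if-if true  true  y z = refl
  if-if true  false y z = refl
  if-if false true  y z = refl
  if-if false false y z = refl
  exchange : ∀ x (y z : Vector Bool _) →
             (if m′ x then (if m x then z x else y x) else (if m x then y x else z x)) ≡ (if k x then y x else z x)
  exchange x y z = trans (if-if (m x) (m′ x) (y x) (z x)) (cong (λ b → if b then y x else z x) (sym (k≡m⊕m′ x)))

swap-involutive : (m : Vector Bool n) (pq : Pair n) → swap m (swap m pq) ≋ pq
swap-involutive m = swap-swap m m (λ _ → false) (λ x → sym (xor-same (m x)))

swap-cong : {m m′ : Vector Bool n} → m ≗ m′ → (pq : Pair n) → swap m pq ≋ swap m′ pq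
swap-cong m≗m′ (p , q) = (λ x → cong (λ b → if b then q x else p x) (m≗m′ x)) ,
                         (λ x → cong (λ b → if b then p x else q x) (m≗m′ x))

module ExchangeTwo (u v : Fin n) (pq : Pair n) where
  p q d correction : Vector Bool n
  p = proj₁ pq
  q = proj₂ pq
  d = p ⊕ q
  correction j = (d u ∧ δ u j) xor (d v ∧ δ v j)

  if-as-xor : ∀ (b y z : Bool) → (if b then z else y) ≡ y xor (b ∧ (y xor z))
  if-as-xor true  y z = solve 2 (λ y z → z := y :+ (y :+ z)) refl y z
  if-as-xor false y z = sym (xor-identityʳ y)

  select-two : ∀ x → (δ u x xor δ v x) ∧ d x ≡ correction x
  select-two x = begin
    (δ u x xor δ v x) ∧ d x               ≡⟨ ∧-distribʳ-xor (d x) (δ u x) (δ v x) ⟩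
    (δ u x ∧ d x) xor (δ v x ∧ d x)       ≡⟨ cong₂ _xor_ (δ-select d x u) (δ-select d x v) ⟩
    (δ u x ∧ d u) xor (δ v x ∧ d v)       ≡⟨ cong₂ _xor_ (∧-comm (δ u x) (d u)) (∧-comm (δ v x) (d v)) ⟩
    correction x                          ∎
    where open ≡-Reasoning

  exchange-two : swap (δ u ⊕ δ v) pq ≋ (p ⊕ correction , q ⊕ correction)
  exchange-two = (λ x → trans (if-as-xor _ (p x) (q x)) (cong (p x xor_) (select-two x))) ,
                 (λ x → trans (if-as-xor _ (q x) (p x))
                              (cong (q x xor_) (trans (cong (_ ∧_) (xor-comm (q x) (p x))) (select-two x))))

  dot-exchanged : (r : Vector Bool n) → r ∙ proj₁ (swap (δ u ⊕ δ v) pq) ≡ r ∙ p xor ((d u ∧ r u) xor (d v ∧ r v))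
  dot-exchanged r = begin
    r ∙ proj₁ (swap (δ u ⊕ δ v) pq)                       ≡⟨ ∙-congʳ r (proj₁ exchange-two) ⟩
    r ∙ (p ⊕ correction)                                  ≡⟨ ∙-⊕ʳ r p correction ⟩
    r ∙ p xor r ∙ correction                              ≡⟨ cong (r ∙ p xor_) (∙-⊕ʳ r _ _) ⟩
    r ∙ p xor (r ∙ (λ j → d u ∧ δ u j) xor r ∙ (λ j → d v ∧ δ v j))
        ≡⟨ cong (r ∙ p xor_) (cong₂ _xor_ (∙-scaleʳ (d u) r (δ u)) (∙-scaleʳ (d v) r (δ v))) ⟩
    r ∙ p xor ((d u ∧ r ∙ δ u) xor (d v ∧ r ∙ δ v))
        ≡⟨ cong (r ∙ p xor_) (cong₂ (λ z w → (d u ∧ z) xor (d v ∧ w)) (∙-δʳ r u) (∙-δʳ r v)) ⟩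
    r ∙ p xor ((d u ∧ r u) xor (d v ∧ r v))               ∎
    where open ≡-Reasoning

-- A pivot is a symmetric rank-two update
--
-- With s = N'(u) and t = N'(v), a pair x, y is toggled by the pivot on uv
-- exactly when s x t y + t x s y = 1, i.e. a[uv] = a + s tᵀ + t sᵀ.

differ-rank-two : (a : Matrix n) (u v x y : Fin n) →
  differ (cls a u v x) (cls a u v y) ≡ (inN' a u x ∧ inN' a v y) xor (inN' a v x ∧ inN' a u y)
differ-rank-two a u v x y with inN' a u x | inN' a v x | inN' a u y | inN' a v y
... | false | false | _     | _     = refl
... | true  | false | false | false = refl
... | false | true  | false | false = refl
... | true  | true  | false | false = refl
... | true  | false | true  | false = refl
... | true  | false | false | true  = refl
... | true  | false | true  | true  = refl
... | false | true  | true  | false = refl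
... | false | true  | false | true  = refl
... | false | true  | true  | true  = refl
... | true  | true  | true  | false = refl
... | true  | true  | false | true  = refl
... | true  | true  | true  | true  = refl

pivot-rank-two : (a : Matrix n) (u v x y : Fin n) →
  pivotAdj a u v x y ≡ a x y xor ((inN' a u x ∧ inN' a v y) xor (inN' a v x ∧ inN' a u y))
pivot-rank-two a u v x y = cong (a x y xor_) (differ-rank-two a u v x y)

pivot-row-dot : (a : Matrix n) (u v x : Fin n) (r : Vector Bool n) →
  pivotAdj a u v x ∙ r ≡ a x ∙ r xor ((inN' a u x ∧ inN' a v ∙ r) xor (inN' a v x ∧ inN' a u ∙ r))
pivot-row-dot a u v x r = begin
  pivotAdj a u v x ∙ r                         ≡⟨ ∙-congˡ (pivot-rank-two a u v x) r ⟩
  (a x ⊕ (S ⊕ T)) ∙ r                          ≡⟨ ∙-⊕ˡ (a x) (S ⊕ T) r ⟩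
  a x ∙ r xor (S ⊕ T) ∙ r                      ≡⟨ cong (a x ∙ r xor_) (∙-⊕ˡ S T r) ⟩
  a x ∙ r xor (S ∙ r xor T ∙ r)
      ≡⟨ cong (a x ∙ r xor_) (cong₂ _xor_ (∙-scaleˡ (s x) t r) (∙-scaleˡ (t x) s r)) ⟩
  a x ∙ r xor ((s x ∧ t ∙ r) xor (t x ∧ s ∙ r)) ∎
  where
  open ≡-Reasoning
  s t S T : Vector Bool _
  s = inN' a u
  t = inN' a v
  S j = s x ∧ t j
  T j = t x ∧ s j

closed-nbhd : (G : Graph n) (u : Fin n) → inN' (adj G) u ≗ δ u ⊕ adj G u
closed-nbhd G u x with x ≟ u
... | yes refl = cong (true xor_) (sym (irref G x))
... | no _     = refl

pivotGraph : Graph n → Fin n → Fin n → Graph n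
pivotGraph G u v = mkGraph (pivotAdj a u v) symmetric loopless
  where
  open ≡-Reasoning
  a : Matrix _
  a = adj G
  s t : Vector Bool _
  s = inN' a u
  t = inN' a v
  symmetric : ∀ x y → pivotAdj a u v x y ≡ pivotAdj a u v y x
  symmetric x y = begin
    pivotAdj a u v x y                               ≡⟨ pivot-rank-two a u v x y ⟩
    a x y xor ((s x ∧ t y) xor (t x ∧ s y))          ≡⟨ cong (_xor ((s x ∧ t y) xor (t x ∧ s y))) (Graph.sym G x y) ⟩
    a y x xor ((s x ∧ t y) xor (t x ∧ s y))
        ≡⟨ solve 5 (λ A sx ty tx sy → A :+ ((sx :* ty) :+ (tx :* sy)) := A :+ ((sy :* tx) :+ (ty :* sx)))
                   refl (a y x) (s x) (t y) (t x) (s y) ⟩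
    a y x xor ((s y ∧ t x) xor (t y ∧ s x))          ≡⟨ sym (pivot-rank-two a u v y x) ⟩
    pivotAdj a u v y x                               ∎
  loopless : ∀ x → pivotAdj a u v x x ≡ false
  loopless x = begin
    pivotAdj a u v x x                               ≡⟨ pivot-rank-two a u v x x ⟩
    a x x xor ((s x ∧ t x) xor (t x ∧ s x))
        ≡⟨ solve 3 (λ A sx tx → A :+ ((sx :* tx) :+ (tx :* sx)) := A) refl (a x x) (s x) (t x) ⟩
    a x x                                            ≡⟨ irref G x ⟩
    false                                            ∎

-- The principal pivot lemma for a single edge uv

module PivotOnEdge (G : Graph n) (u v : Fin n) (uv : adj G u v ≡ true) where
  open ≡-Reasoning

  a B : Matrix n
  a = adj G
  B = pivotAdj a u v

  s t m : Vector Bool n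
  s = inN' a u
  t = inN' a v
  m = δ u ⊕ δ v

  s-u : s u ≡ true
  s-u = cong (_∨ a u u) (==-refl u)

  t-v : t v ≡ true
  t-v = cong (_∨ a v v) (==-refl v)

  s-v : s v ≡ true
  s-v = trans (cong (v == u ∨_) uv) (∨-zeroʳ (v == u))

  t-u : t u ≡ true
  t-u = trans (cong (u == v ∨_) (trans (Graph.sym G v u) uv)) (∨-zeroʳ (u == v))

  module _ (pq : Pair n) (h : Maps a pq) where
    open ExchangeTwo u v pq using (p; q; d; dot-exchanged; exchange-two)

    P : Vector Bool n
    P = proj₁ (swap m pq)

    nbhd-dot : (w : Fin n) → inN' a w ∙ p ≡ d w
    nbhd-dot w = begin
      inN' a w ∙ p             ≡⟨ ∙-congˡ (closed-nbhd G w) p ⟩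
      (δ w ⊕ a w) ∙ p          ≡⟨ ∙-⊕ˡ (δ w) (a w) p ⟩
      δ w ∙ p xor a w ∙ p      ≡⟨ cong₂ _xor_ (∙-δˡ w p) (sym (h w)) ⟩
      d w                      ∎

    t-dot : t ∙ P ≡ d u
    t-dot = begin
      t ∙ P                                         ≡⟨ dot-exchanged t ⟩
      t ∙ p xor ((d u ∧ t u) xor (d v ∧ t v))       ≡⟨ cong₂ (λ z w → t ∙ p xor ((d u ∧ z) xor (d v ∧ w))) t-u t-v ⟩
      t ∙ p xor ((d u ∧ true) xor (d v ∧ true))     ≡⟨ cong (_xor _) (nbhd-dot v) ⟩
      d v xor ((d u ∧ true) xor (d v ∧ true))
          ≡⟨ solve 2 (λ du dv → dv :+ ((du :* con true) :+ (dv :* con true)) := du) refl (d u) (d v) ⟩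
      d u                                           ∎

    s-dot : s ∙ P ≡ d v
    s-dot = begin
      s ∙ P                                         ≡⟨ dot-exchanged s ⟩
      s ∙ p xor ((d u ∧ s u) xor (d v ∧ s v))       ≡⟨ cong₂ (λ z w → s ∙ p xor ((d u ∧ z) xor (d v ∧ w))) s-u s-v ⟩
      s ∙ p xor ((d u ∧ true) xor (d v ∧ true))     ≡⟨ cong (_xor _) (nbhd-dot u) ⟩
      d u xor ((d u ∧ true) xor (d v ∧ true))
          ≡⟨ solve 2 (λ du dv → du :+ ((du :* con true) :+ (dv :* con true)) := dv) refl (d u) (d v) ⟩
      d v                                           ∎

    -- a[uv] P = Q: the a-terms of the rank-two update cancel, leaving the correction at u and v
    pivot-forward : Maps B (swap m pq)
    pivot-forward x = sym (begin
      B x ∙ P                                                         ≡⟨ pivot-row-dot a u v x P ⟩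
      a x ∙ P xor ((s x ∧ t ∙ P) xor (t x ∧ s ∙ P))                   ≡⟨ cong₂ (λ z w → a x ∙ P xor ((s x ∧ z) xor (t x ∧ w))) t-dot s-dot ⟩
      a x ∙ P xor ((s x ∧ d u) xor (t x ∧ d v))                       ≡⟨ cong (_xor ((s x ∧ d u) xor (t x ∧ d v))) (dot-exchanged (a x)) ⟩
      (a x ∙ p xor ((d u ∧ a x u) xor (d v ∧ a x v))) xor ((s x ∧ d u) xor (t x ∧ d v))
          ≡⟨ cong (λ z → (z xor ((d u ∧ a x u) xor (d v ∧ a x v))) xor ((s x ∧ d u) xor (t x ∧ d v))) (sym (h x)) ⟩
      (q x xor ((d u ∧ a x u) xor (d v ∧ a x v))) xor ((s x ∧ d u) xor (t x ∧ d v))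
          ≡⟨ cong₂ (λ z w → (q x xor ((d u ∧ z) xor (d v ∧ w))) xor ((s x ∧ d u) xor (t x ∧ d v)))
                   (Graph.sym G x u) (Graph.sym G x v) ⟩
      (q x xor ((d u ∧ a u x) xor (d v ∧ a v x))) xor ((s x ∧ d u) xor (t x ∧ d v))
          ≡⟨ cong₂ (λ z w → (q x xor ((d u ∧ a u x) xor (d v ∧ a v x))) xor ((z ∧ d u) xor (w ∧ d v)))
                   (closed-nbhd G u x) (closed-nbhd G v x) ⟩
      (q x xor ((d u ∧ a u x) xor (d v ∧ a v x))) xor ((((x == u) xor a u x) ∧ d u) xor (((x == v) xor a v x) ∧ d v))
          ≡⟨ solve 7 (λ q du dv A A′ e e′ → (q :+ ((du :* A) :+ (dv :* A′))) :+ (((e :+ A) :* du) :+ ((e′ :+ A′) :* dv))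
                                            := q :+ ((du :* e) :+ (dv :* e′)))
                     refl (q x) (d u) (d v) (a u x) (a v x) (x == u) (x == v) ⟩
      q x xor ((d u ∧ (x == u)) xor (d v ∧ (x == v)))                 ≡⟨ sym (proj₂ exchange-two x) ⟩
      proj₂ (swap m pq) x                                             ∎)

  -- a[uv] still has the edge uv, with N'(u) and N'(v) exchanged; hence pivoting on uv is an involution
  pivot-keeps-edge : B u v ≡ true
  pivot-keeps-edge = begin
    B u v                                        ≡⟨ pivot-rank-two a u v u v ⟩
    a u v xor ((s u ∧ t v) xor (t u ∧ s v))      ≡⟨ cong₂ (λ z w → z xor ((s u ∧ t v) xor (w ∧ s v))) uv t-u ⟩
    true xor ((s u ∧ t v) xor s v)               ≡⟨ cong₂ (λ z w → true xor ((z ∧ t v) xor w)) s-u s-v ⟩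
    true xor (t v xor true)                      ≡⟨ cong (λ z → true xor (z xor true)) t-v ⟩
    true                                         ∎

  nbhd-after-u : inN' B u ≗ t
  nbhd-after-u x = begin
    inN' B u x                                           ≡⟨ closed-nbhd (pivotGraph G u v) u x ⟩
    (x == u) xor B u x                                   ≡⟨ cong ((x == u) xor_) (pivot-rank-two a u v u x) ⟩
    (x == u) xor (a u x xor ((s u ∧ t x) xor (t u ∧ s x)))
        ≡⟨ cong₂ (λ z w → (x == u) xor (a u x xor ((z ∧ t x) xor (w ∧ s x)))) s-u t-u ⟩
    (x == u) xor (a u x xor (t x xor s x))               ≡⟨ cong (λ z → (x == u) xor (a u x xor (t x xor z))) (closed-nbhd G u x) ⟩
    (x == u) xor (a u x xor (t x xor ((x == u) xor a u x)))
        ≡⟨ solve 3 (λ e A T → e :+ (A :+ (T :+ (e :+ A))) := T) refl (x == u) (a u x) (t x) ⟩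
    t x                                                  ∎

  nbhd-after-v : inN' B v ≗ s
  nbhd-after-v x = begin
    inN' B v x                                           ≡⟨ closed-nbhd (pivotGraph G u v) v x ⟩
    (x == v) xor B v x                                   ≡⟨ cong ((x == v) xor_) (pivot-rank-two a u v v x) ⟩
    (x == v) xor (a v x xor ((s v ∧ t x) xor (t v ∧ s x)))
        ≡⟨ cong₂ (λ z w → (x == v) xor (a v x xor ((z ∧ t x) xor (w ∧ s x)))) s-v t-v ⟩
    (x == v) xor (a v x xor (t x xor s x))               ≡⟨ cong (λ z → (x == v) xor (a v x xor (z xor s x))) (closed-nbhd G v x) ⟩
    (x == v) xor (a v x xor (((x == v) xor a v x) xor s x))
        ≡⟨ solve 3 (λ e A S → e :+ (A :+ ((e :+ A) :+ S)) := S) refl (x == v) (a v x) (s x) ⟩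
    s x                                                  ∎

  pivot-involutive : ∀ x y → pivotAdj B u v x y ≡ a x y
  pivot-involutive x y = begin
    pivotAdj B u v x y                                         ≡⟨ pivot-rank-two B u v x y ⟩
    B x y xor ((inN' B u x ∧ inN' B v y) xor (inN' B v x ∧ inN' B u y))
        ≡⟨ cong₂ (λ z w → B x y xor (z xor w))
                 (cong₂ _∧_ (nbhd-after-u x) (nbhd-after-v y)) (cong₂ _∧_ (nbhd-after-v x) (nbhd-after-u y)) ⟩
    B x y xor ((t x ∧ s y) xor (s x ∧ t y))                    ≡⟨ cong (_xor ((t x ∧ s y) xor (s x ∧ t y))) (pivot-rank-two a u v x y) ⟩
    (a x y xor ((s x ∧ t y) xor (t x ∧ s y))) xor ((t x ∧ s y) xor (s x ∧ t y))
        ≡⟨ solve 5 (λ A sx ty tx sy → (A :+ ((sx :* ty) :+ (tx :* sy))) :+ ((tx :* sy) :+ (sx :* ty)) := A)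
                   refl (a x y) (s x) (t y) (t x) (s y) ⟩
    a x y                                                      ∎

pivot-relation : (G : Graph n) (u v : Fin n) → adj G u v ≡ true → (pq : Pair n) →
                 Maps (pivotAdj (adj G) u v) pq ⇔ Maps (adj G) (swap (δ u ⊕ δ v) pq)
pivot-relation G u v uv pq = mk⇔ into-original into-pivoted
  where
  open PivotOnEdge G u v uv using (pivot-forward; pivot-keeps-edge; pivot-involutive)
  -- forward along the pivot on a, and back along the pivot on a[uv] using involutivity
  into-pivoted : Maps (adj G) (swap (δ u ⊕ δ v) pq) → Maps (pivotAdj (adj G) u v) pq
  into-pivoted h = Maps-resp (λ _ _ → refl) (swap-involutive (δ u ⊕ δ v) pq) (pivot-forward (swap (δ u ⊕ δ v) pq) h)
  into-original : Maps (pivotAdj (adj G) u v) pq → Maps (adj G) (swap (δ u ⊕ δ v) pq)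
  into-original h = Maps-resp pivot-involutive ((λ _ → refl) , (λ _ → refl))
                      (PivotOnEdge.pivot-forward (pivotGraph G u v) u v pivot-keeps-edge pq h)

-- Sequences of pivots: the relation of Gφ is that of G exchanged on sup(φ)

pivots-relation : (G : Graph n) (φ : PivotSeq n) → Applicable (adj G) φ → (pq : Pair n) →
                  Maps (G · φ) pq ⇔ Maps (adj G) (swap (inSup φ) pq)
pivots-relation G []            _         pq = ⇔.refl
pivots-relation G ((u , v) ∷ φ) (uv , ap) pq =
  ⇔.trans (pivots-relation (pivotGraph G u v) φ ap pq)
  (⇔.trans (pivot-relation G u v uv (swap (inSup φ) pq))
           (Maps-≋ (swap-swap (inSup φ) (δ u ⊕ δ v) (inSup ((u , v) ∷ φ)) support-step pq)))
  where
  support-step : ∀ x → inSup ((u , v) ∷ φ) x ≡ inSup φ x xor (δ u ⊕ δ v) x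
  support-step x = solve 3 (λ e e′ S → e :+ (e′ :+ S) := S :+ (e :+ e′)) refl (x == u) (x == v) (inSup φ x)

-- The theorem: column y of Gφ is determined by the relation of G and sup(φ)

theorem3 : {n : ℕ} (G : Graph n) (φ φ′ : PivotSeq n)
    → Applicable (adj G) φ
    → Applicable (adj G) φ′
    → (∀ x → inSup φ x ≡ inSup φ′ x)
    → ∀ x y → (G · φ) x y ≡ (G · φ′) x y
theorem3 G φ φ′ ap ap′ same-support x y = Maps-column (G · φ′) column-after-φ′ x
  where
  column : Pair _
  column = δ y , λ z → (G · φ) z y
  column-before : Maps (adj G) (swap (inSup φ) column)
  column-before = to (pivots-relation G φ ap column) (column-Maps (G · φ) y)
  column-after-φ′ : Maps (G · φ′) column
  column-after-φ′ = from (pivots-relation G φ′ ap′ column)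
                         (to (Maps-≋ (swap-cong same-support column)) column-before)
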